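{- Let $n$ be a positive integer and $m \in \mathbb{Z}$. Then there exists a positive integer $D$ such that the continued fraction expansion of $\sqrt{D}$ has period length $4$ and $D \equiv m \pmod n$.
   Context: For a positive integer $D$ that is not a perfect square, $\sqrt{D} = [a_0; \overline{a_1, \ldots, a_k}]$ is eventually periodic with $a_k = 2a_0$ and $(a_1,\dots,a_{k-1})$ a palindrome; the period length is the minimal such $k$. -}

module Defs where

open import Data.Nat using (ℕ; zero; suc; _+_; _*_; _∸_; _≤_; _<_; _≤ᵇ_)
open import Data.Nat.DivMod using (_/_)
open import Data.Bool using (if_then_else_)
open import Data.Product using (_×_; ∃-syntax)
open import Relation.Binary.PropositionalEquality using (_≡_)
open import Relation.Nullary using (¬_)

isqrt : ℕ → ℕ
isqrt zero = zero
isqrt (suc n) with isqrt n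
... | r = if (suc r * suc r) ≤ᵇ suc n then suc r else r

-- division, with the (never used) convention x / 0 = 0
_div′_ : ℕ → ℕ → ℕ
x div′ zero = zero
x div′ (suc q) = x / suc q

IsSquare : ℕ → Set
IsSquare D = ∃[ k ] (k * k ≡ D)

-- Complete quotients of √D: α_k = (P_k + √D) / Q_k, with
--   P_0 = 0, Q_0 = 1,
--   a_k = ⌊α_k⌋ = ⌊(P_k + ⌊√D⌋) / Q_k⌋,
--   P_{k+1} = a_k Q_k − P_k,   Q_{k+1} = (D − P_{k+1}²) / Q_k.
-- (Standard exact recursion; for non-square D all P_k ≥ 0, Q_k > 0 and
--  the divisions are exact, so ℕ-arithmetic is faithful.)
PQ : ℕ → ℕ → ℕ × ℕ
PQ D zero = 0 Data.Product., 1
PQ D (suc k) with PQ D k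
... | P Data.Product., Q =
  let a  = (P + isqrt D) div′ Q
      P′ = a * Q ∸ P
  in P′ Data.Product., ((D ∸ P′ * P′) div′ Q)

cfSqrt : ℕ → ℕ → ℕ
cfSqrt D k with PQ D k
... | P Data.Product., Q = (P + isqrt D) div′ Q

IsPeriod : ℕ → ℕ → Set
IsPeriod D k = 0 < k × (∀ i → 1 ≤ i → cfSqrt D (i + k) ≡ cfSqrt D i)

PeriodLength : ℕ → ℕ → Set
PeriodLength D k = IsPeriod D k × (∀ j → IsPeriod D j → k ≤ j)

{-# OPTIONS --safe #-}
module Submission where

-- For t, w ≥ 2 let D = t²w² − w, s = tw − 1 and p = (t − 1)w. The complete quotients
-- (P, Q) of √D run through (0, 1), (s, s + p), (p, w), (p, s + p), (s, 1), (s, s + p), …,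
-- so √D = [s; 1, 2t − 2, 1, 2s], and the period is exactly 4 because the last digit 2s
-- exceeds the others. As tw = s + 1, D ≡ −w (mod t); taking t = 2n and w ≡ −m (mod n)
-- gives D ≡ m (mod n).

open import Defs
open import Data.Nat using (ℕ; _<_)
open import Data.Integer using (ℤ; +_; _-_)
open import Data.Integer.Divisibility using (_∣_)
open import Data.Product using (_×_; ∃-syntax)
open import Relation.Nullary using (¬_)

open import Data.Nat using (zero; suc; _+_; _*_; _∸_; _≤_; _≤ᵇ_; _<?_; NonZero; z≤n; s≤s)
open import Data.Nat.Properties
open import Data.Nat.DivMod using (_/_; m*n/n≡m; m<n⇒m/n≡0; +-distrib-/-∣ˡ)
open import Data.Nat.Divisibility as ℕ∣ using (divides-refl; m∣m*n; ∣m⇒∣m*n)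
open import Data.Nat.Tactic.RingSolver using (solve-∀)
import Data.Integer as ℤ
open import Data.Integer.Properties as ℤP using (pos-+)
open import Data.Integer.DivMod using (_%ℕ_; _/ℕ_; a≡a%ℕn+[a/ℕn]*n; n%ℕd<d)
open import Data.Integer.Divisibility.Signed as ℤ∣
  using (∣ᵤ⇒∣; ∣⇒∣ᵤ; ∣-refl; ∣n⇒∣m*n; ∣m∣n⇒∣m+n; ∣m∣n⇒∣m-n)
import Data.Integer.Tactic.RingSolver as ℤ-Solver
open import Data.Bool using (true; false; T)
open import Data.Unit using (tt)
open import Data.Product using (_,_; proj₁; proj₂)
open import Relation.Nullary using (yes; no; contradiction)
open import Relation.Binary.PropositionalEquality

isqrt-bounds : ∀ n → isqrt n * isqrt n ≤ n × n < suc (isqrt n) * suc (isqrt n)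
isqrt-bounds zero = z≤n , s≤s z≤n
isqrt-bounds (suc n) with isqrt n | isqrt-bounds n
... | r | (r²≤n , n<[1+r]²) with suc r * suc r ≤ᵇ suc n in eq
... | true  = ≤ᵇ⇒≤ (suc r * suc r) (suc n) (subst T (sym eq) tt)
            , ≤-<-trans n<[1+r]² (*-mono-< (n<1+n (suc r)) (n<1+n (suc r)))
... | false = m≤n⇒m≤1+n r²≤n , ≰⇒> (λ le → subst T eq (≤⇒≤ᵇ le))

square-cancel-< : ∀ {x y} → x * x < y * y → x < y
square-cancel-< {x} {y} x²<y² with x <? y
... | yes x<y = x<y
... | no  x≮y = contradiction x²<y² (≤⇒≯ (*-mono-≤ (≮⇒≥ x≮y) (≮⇒≥ x≮y)))

isqrt-unique : ∀ {n s} → s * s ≤ n → n < suc s * suc s → isqrt n ≡ s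
isqrt-unique {n} {s} s²≤n n<[1+s]² = ≤-antisym
  (≤-pred (square-cancel-< {isqrt n} {suc s} (≤-<-trans (proj₁ (isqrt-bounds n)) n<[1+s]²)))
  (≤-pred (square-cancel-< {s} {suc (isqrt n)} (≤-<-trans s²≤n (proj₂ (isqrt-bounds n)))))

between-squares⇒¬IsSquare : ∀ {n s} → s * s < n → n < suc s * suc s → ¬ IsSquare n
between-squares⇒¬IsSquare {n} {s} s²<n n<[1+s]² (x , x²≡n) =
  <⇒≱ (square-cancel-< {s} {x} (subst (s * s <_) (sym x²≡n) s²<n))
      (≤-pred (square-cancel-< {x} {suc s} (subst (_< suc s * suc s) (sym x²≡n) n<[1+s]²)))

[q*n+e]/n≡q : ∀ q {n e} .{{_ : NonZero n}} → e < n → (q * n + e) / n ≡ q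
[q*n+e]/n≡q q {n} {e} e<n = begin
  (q * n + e) / n      ≡⟨ +-distrib-/-∣ˡ e (divides-refl q) ⟩
  q * n / n + e / n    ≡⟨ cong₂ _+_ (m*n/n≡m q n) (m<n⇒m/n≡0 e<n) ⟩
  q + 0                ≡⟨ +-identityʳ q ⟩
  q                    ∎
  where open ≡-Reasoning

digit : ℕ → ℕ × ℕ → ℕ
digit D (P , Q) = (P + isqrt D) div′ Q

next : ℕ → ℕ × ℕ → ℕ × ℕ
next D (P , Q) = let P′ = digit D (P , Q) * Q ∸ P in P′ , (D ∸ P′ * P′) div′ Q

-- One step (P, Q) ↦ (P′, Q′) with digit a, certified by P′ = aQ − P and ⌊√D⌋ = P′ + e
-- with e < Q (so that a = ⌊(P + ⌊√D⌋)/Q⌋), and D − P′² = Q′Q.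
PQ-step : ∀ D k {s P d a e P′ Q′} → isqrt D ≡ s → PQ D k ≡ (P , suc d) →
  e + P′ ≡ s → e < suc d → a * suc d ≡ P + P′ → D ≡ P′ * P′ + Q′ * suc d →
  cfSqrt D k ≡ a × PQ D (suc k) ≡ (P′ , Q′)
PQ-step D k {s} {P} {d} {a} {e} {P′} {Q′} √D≡s PQ≡ e+P′≡s e<Q aQ≡P+P′ D≡ =
  trans (cong (digit D) PQ≡) digit≡a , trans (cong (next D) PQ≡) (cong₂ _,_ P′≡ Q′≡)
  where
  open ≡-Reasoning
  digit≡a : (P + isqrt D) / suc d ≡ a
  digit≡a = begin
    (P + isqrt D) / suc d       ≡⟨ cong (λ x → (P + x) / suc d) (trans √D≡s (sym e+P′≡s)) ⟩
    (P + (e + P′)) / suc d      ≡⟨ cong (_/ suc d) (+-comm P (e + P′)) ⟩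
    ((e + P′) + P) / suc d      ≡⟨ cong (_/ suc d) (+-assoc e P′ P) ⟩
    (e + (P′ + P)) / suc d      ≡⟨ cong (λ x → (e + x) / suc d) (trans (+-comm P′ P) (sym aQ≡P+P′)) ⟩
    (e + a * suc d) / suc d     ≡⟨ cong (_/ suc d) (+-comm e (a * suc d)) ⟩
    (a * suc d + e) / suc d     ≡⟨ [q*n+e]/n≡q a e<Q ⟩
    a                           ∎
  computed-P′ : ℕ
  computed-P′ = (P + isqrt D) / suc d * suc d ∸ P
  P′≡ : computed-P′ ≡ P′
  P′≡ = begin
    (P + isqrt D) / suc d * suc d ∸ P   ≡⟨ cong (λ x → x * suc d ∸ P) digit≡a ⟩
    a * suc d ∸ P                       ≡⟨ cong (_∸ P) aQ≡P+P′ ⟩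
    P + P′ ∸ P                          ≡⟨ m+n∸m≡n P P′ ⟩
    P′                                  ∎
  Q′≡ : (D ∸ computed-P′ * computed-P′) / suc d ≡ Q′
  Q′≡ = begin
    (D ∸ computed-P′ * computed-P′) / suc d
      ≡⟨ cong (λ x → (D ∸ x * x) / suc d) P′≡ ⟩
    (D ∸ P′ * P′) / suc d
      ≡⟨ cong (λ x → (x ∸ P′ * P′) / suc d) D≡ ⟩
    (P′ * P′ + Q′ * suc d ∸ P′ * P′) / suc d
      ≡⟨ cong (_/ suc d) (m+n∸m≡n (P′ * P′) (Q′ * suc d)) ⟩
    Q′ * suc d / suc d
      ≡⟨ m*n/n≡m Q′ (suc d) ⟩
    Q′ ∎

IsPeriod-of-PQ-return : ∀ {D k} → 0 < k → PQ D (1 + k) ≡ PQ D 1 → IsPeriod D k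
IsPeriod-of-PQ-return {D} {k} 0<k return = 0<k , periodic
  where
  PQ-periodic : ∀ j → PQ D (suc j + k) ≡ PQ D (suc j)
  PQ-periodic zero    = return
  PQ-periodic (suc j) = cong (next D) (PQ-periodic j)
  periodic : ∀ i → 1 ≤ i → cfSqrt D (i + k) ≡ cfSqrt D i
  periodic (suc j) _ = cong (digit D) (PQ-periodic j)

-- A shorter period j would force a_{k−j} = a_k.
PeriodLength-of-distinct-last : ∀ {D k} → IsPeriod D k →
  (∀ i → 1 ≤ i → i < k → cfSqrt D i ≢ cfSqrt D k) → PeriodLength D k
PeriodLength-of-distinct-last {D} {k} period distinct = period , minimal
  where
  minimal : ∀ j → IsPeriod D j → k ≤ j
  minimal j (0<j , periodic) with j <? k
  ... | no  j≮k = ≮⇒≥ j≮k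
  ... | yes j<k = contradiction (sym aₖ≡aᵢ) (distinct i 1≤i (∸-monoʳ-< 0<j (<⇒≤ j<k)))
    where
    i : ℕ
    i = k ∸ j
    1≤i : 1 ≤ i
    1≤i = m<n⇒0<n∸m j<k
    aₖ≡aᵢ : cfSqrt D k ≡ cfSqrt D i
    aₖ≡aᵢ = subst (λ x → cfSqrt D x ≡ cfSqrt D i) (m∸n+n≡m (<⇒≤ j<k)) (periodic i 1≤i)

-- D = t²w² − w with t = a + 2 and w = b + 2; r = D − s² = s + p.
module PeriodFourFamily (a b : ℕ) where
  u w p s r D : ℕ
  u = suc a
  w = 2 + b
  p = u * w
  s = suc b + p
  r = s + p
  D = s * s + r

  D≡p²+wr : D ≡ p * p + w * r
  D≡p²+wr = identity b p
    where
    identity : ∀ b p → let s = suc b + p in s * s + (s + p) ≡ p * p + (2 + b) * (s + p)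
    identity = solve-∀

  [1+s]²≡D+w : suc s * suc s ≡ D + w
  [1+s]²≡D+w = identity b p
    where
    identity : ∀ b p → let s = suc b + p in suc s * suc s ≡ s * s + (s + p) + (2 + b)
    identity = solve-∀

  s²<D : s * s < D
  s²<D = m<m+n (s * s) 0<1+n

  D<[1+s]² : D < suc s * suc s
  D<[1+s]² = subst (D <_) (sym [1+s]²≡D+w) (m<m+n D 0<1+n)

  isqrt-D : isqrt D ≡ s
  isqrt-D = isqrt-unique (<⇒≤ s²<D) D<[1+s]²

  step₀ : cfSqrt D 0 ≡ s × PQ D 1 ≡ (s , r)
  step₀ = PQ-step D 0 isqrt-D refl refl
    0<1+n (*-identityʳ s) (cong (_+_ (s * s)) (sym (*-identityʳ r)))

  step₁ : cfSqrt D 1 ≡ 1 × PQ D 2 ≡ (p , w)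
  step₁ = PQ-step D 1 isqrt-D (proj₂ step₀) refl
    (≤-<-trans (m≤m+n (suc b) p) (m<m+n s 0<1+n)) (*-identityˡ r) D≡p²+wr

  step₂ : cfSqrt D 2 ≡ u + u × PQ D 3 ≡ (p , r)
  step₂ = PQ-step D 2 isqrt-D (proj₂ step₁) refl
    ≤-refl (*-distribʳ-+ w u u) (trans D≡p²+wr (cong (_+_ (p * p)) (*-comm w r)))

  step₃ : cfSqrt D 3 ≡ 1 × PQ D 4 ≡ (s , 1)
  step₃ = PQ-step D 3 isqrt-D (proj₂ step₂) refl
    0<1+n (trans (*-identityˡ r) (+-comm s p)) (cong (_+_ (s * s)) (sym (*-identityˡ r)))

  step₄ : cfSqrt D 4 ≡ s + s × PQ D 5 ≡ (s , r)
  step₄ = PQ-step D 4 isqrt-D (proj₂ step₃) refl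
    0<1+n (*-identityʳ (s + s)) (cong (_+_ (s * s)) (sym (*-identityʳ r)))

  period : IsPeriod D 4
  period = IsPeriod-of-PQ-return 0<1+n (trans (proj₂ step₄) (sym (proj₂ step₀)))

  periodLength : PeriodLength D 4
  periodLength = PeriodLength-of-distinct-last period distinct
    where
    u<s : u < s
    u<s = ≤-<-trans (m≤m*n u w) (m<n+m p 0<1+n)
    2u<2s : u + u < s + s
    2u<2s = +-mono-< u<s u<s
    1<2s : 1 < s + s
    1<2s = ≤-<-trans (s≤s z≤n) 2u<2s
    below-last : ∀ i {x} → cfSqrt D i ≡ x → x < s + s → cfSqrt D i ≢ cfSqrt D 4
    below-last _ aᵢ≡x x<2s aᵢ≡a₄ = <⇒≢ x<2s (trans (sym aᵢ≡x) (trans aᵢ≡a₄ (proj₁ step₄)))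
    distinct : ∀ i → 1 ≤ i → i < 4 → cfSqrt D i ≢ cfSqrt D 4
    distinct 1 _ _ = below-last 1 (proj₁ step₁) 1<2s
    distinct 2 _ _ = below-last 2 (proj₁ step₂) 2u<2s
    distinct 3 _ _ = below-last 3 (proj₁ step₃) 1<2s
    distinct (suc (suc (suc (suc _)))) _ (s≤s (s≤s (s≤s (s≤s ()))))

  ¬IsSquare-D : ¬ IsSquare D
  ¬IsSquare-D = between-squares⇒¬IsSquare s²<D D<[1+s]²

  -- suc s and (2 + a) * w are definitionally equal.
  D≡-w-mod : ∀ {n} m → n ℕ∣.∣ 2 + a → + n ℤ∣.∣ (+ w ℤ.+ m) → + n ℤ∣.∣ (+ D - m)
  D≡-w-mod {n} m n∣t n∣w+m =
    subst (+ n ℤ∣.∣_) D+w-[w+m]≡D-m (∣m∣n⇒∣m-n (∣ᵤ⇒∣ {i = + (suc s * suc s)} n∣[1+s]²) n∣w+m)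
    where
    n∣[1+s]² : n ℕ∣.∣ suc s * suc s
    n∣[1+s]² = ∣m⇒∣m*n (suc s) (∣m⇒∣m*n w n∣t)
    D+w-[w+m]≡D-m : + (suc s * suc s) - (+ w ℤ.+ m) ≡ + D - m
    D+w-[w+m]≡D-m = begin
      + (suc s * suc s) - (+ w ℤ.+ m)   ≡⟨ cong (λ x → + x - (+ w ℤ.+ m)) [1+s]²≡D+w ⟩
      + (D + w) - (+ w ℤ.+ m)           ≡⟨ cong (_- (+ w ℤ.+ m)) (pos-+ D w) ⟩
      (+ D ℤ.+ + w) - (+ w ℤ.+ m)       ≡⟨ cancel (+ D) (+ w) m ⟩
      + D - m                           ∎
      where
      open ≡-Reasoning
      cancel : ∀ x y z → (x ℤ.+ y) - (y ℤ.+ z) ≡ x - z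
      cancel = ℤ-Solver.solve-∀

residue-complement : ∀ n .{{_ : NonZero n}} m → ∃[ b ] (+ n ℤ∣.∣ (+ (2 + b) ℤ.+ m))
residue-complement n@(suc n′) m = b , subst (+ n ℤ∣.∣_) (sym [2+b]+m≡n*2+q*n) n∣2n+qn
  where
  open ≡-Reasoning
  r₀ : ℕ
  r₀ = m %ℕ n
  q : ℤ
  q = m /ℕ n
  r₀≤2n′ : r₀ ≤ n′ * 2
  r₀≤2n′ = ≤-trans (≤-pred (n%ℕd<d m n)) (m≤m*n n′ 2)
  b : ℕ
  b = n′ * 2 ∸ r₀
  [2+b]+m≡n*2+q*n : + (2 + b) ℤ.+ m ≡ + (n * 2) ℤ.+ q ℤ.* + n
  [2+b]+m≡n*2+q*n = begin
    + (2 + b) ℤ.+ m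
      ≡⟨ cong (ℤ._+_ (+ (2 + b))) (a≡a%ℕn+[a/ℕn]*n m n) ⟩
    + (2 + b) ℤ.+ (+ r₀ ℤ.+ q ℤ.* + n)
      ≡⟨ ℤP.+-assoc (+ (2 + b)) (+ r₀) (q ℤ.* + n) ⟨
    (+ (2 + b) ℤ.+ + r₀) ℤ.+ q ℤ.* + n
      ≡⟨ cong (ℤ._+ q ℤ.* + n) (pos-+ (2 + b) r₀) ⟨
    + (2 + b + r₀) ℤ.+ q ℤ.* + n
      ≡⟨ cong (λ x → + (2 + x) ℤ.+ q ℤ.* + n) (m∸n+n≡m r₀≤2n′) ⟩
    + (n * 2) ℤ.+ q ℤ.* + n ∎
  n∣2n+qn : + n ℤ∣.∣ (+ (n * 2) ℤ.+ q ℤ.* + n)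
  n∣2n+qn = ∣m∣n⇒∣m+n (∣ᵤ⇒∣ {i = + (n * 2)} (m∣m*n 2)) (∣n⇒∣m*n q ∣-refl)

theorem2p3 : (n : ℕ) → 0 < n → (m : ℤ) →
    ∃[ D ] (0 < D × ¬ IsSquare D × PeriodLength D 4 × (+ n) ∣ ((+ D) - m))
theorem2p3 n@(suc n′) _ m with residue-complement n m
... | b , n∣w+m = D , 0<1+n , ¬IsSquare-D , periodLength , ∣⇒∣ᵤ (D≡-w-mod m (m∣m*n 2) n∣w+m)
  where open PeriodFourFamily (n′ * 2) b
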